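{- The $8$ holes of a partial plane spread of size $17$ in $\mathrm{PG}(6,2)$ form an affine solid.
   Context: A partial plane spread is a set of $3$-dimensional subspaces (blocks) of $\mathbb{F}_2^7$ pairwise intersecting in $\{0\}$; holes are the $1$-dimensional subspaces (points) not contained in any block. An affine solid is the set of points of a $4$-dimensional subspace $S$ not lying in some fixed $3$-dimensional subspace of $S$. -}

module Defs where

open import Data.Bool using (Bool; true; false; _xor_; _∧_)
open import Data.Nat using (ℕ)
open import Data.Fin using (Fin)
open import Data.Vec using (Vec; []; _∷_; replicate; zipWith; map)
open import Data.Product using (Σ; ∃; _×_; _,_)
open import Relation.Binary.PropositionalEquality using (_≡_)
open import Relation.Nullary using (¬_)
open import Function.Bundles using (_⇔_)

-- Vectors of F_2^n, with F_2 = Bool (xor = addition, ∧ = multiplication).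
Vec₂ : ℕ → Set
Vec₂ n = Vec Bool n

zeroV : ∀ {n} → Vec₂ n
zeroV = replicate _ false

_⊕_ : ∀ {n} → Vec₂ n → Vec₂ n → Vec₂ n
_⊕_ = zipWith _xor_

_·_ : ∀ {n} → Bool → Vec₂ n → Vec₂ n
c · v = map (c ∧_) v

lincomb : ∀ {k n} → Vec Bool k → Vec (Vec₂ n) k → Vec₂ n
lincomb [] [] = zeroV
lincomb (c ∷ cs) (b ∷ bs) = (c · b) ⊕ lincomb cs bs

LinIndep : ∀ {k n} → Vec (Vec₂ n) k → Set
LinIndep {k} bs = ∀ (c : Vec Bool k) → lincomb c bs ≡ zeroV → c ≡ replicate k false

record Subspace (n k : ℕ) : Set where
  constructor subspace
  field
    basis : Vec (Vec₂ n) k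
    indep : LinIndep basis
open Subspace public

_∈ₛ_ : ∀ {n k} → Vec₂ n → Subspace n k → Set
v ∈ₛ U = ∃ λ (c : Vec Bool _) → lincomb c (basis U) ≡ v

_⊆ₛ_ : ∀ {n k l} → Subspace n k → Subspace n l → Set
U ⊆ₛ W = ∀ v → v ∈ₛ U → v ∈ₛ W

-- Points of PG(n-1,2) = 1-dim subspaces of F_2^n, identified with nonzero vectors.
IsPoint : ∀ {n} → Vec₂ n → Set
IsPoint v = ¬ (v ≡ zeroV)

-- Partial plane spread of size m in PG(6,2): m planes (3-dim subspaces of F_2^7),
-- pairwise intersecting in {0}.
PartialPlaneSpread : ℕ → Set
PartialPlaneSpread m =
  Σ (Fin m → Subspace 7 3) λ B →
    ∀ (i j : Fin m) → ¬ (i ≡ j) → ∀ v → v ∈ₛ B i → v ∈ₛ B j → v ≡ zeroV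

IsHole : ∀ {m} → PartialPlaneSpread m → Vec₂ 7 → Set
IsHole {m} (B , _) v = IsPoint v × (∀ (i : Fin m) → ¬ (v ∈ₛ B i))

IsAffineSolid : (Vec₂ 7 → Set) → Set
IsAffineSolid P =
  Σ (Subspace 7 4) λ S → Σ (Subspace 7 3) λ T →
    (T ⊆ₛ S) ×
    (∀ v → IsPoint v → (P v ⇔ (v ∈ₛ S × ¬ (v ∈ₛ T))))

-- The 17 planes cover 17 · 7 of the 127 points of PG(6,2), leaving 8 holes, and a plane
-- meets the complement of a hyperplane in 0 or 4 points, so every hyperplane complement
-- contains 0, 4 or 8 holes. The first two moments of this number over all hyperplanes show
-- that exactly 8 functionals vanish on all holes and that some functional a₀ is 1 on all of
-- them. The vanishing functionals form a 3-dimensional subspace Z; its annihilator has 16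
-- points, 8 of them off a₀⊥, and these 8 contain, hence are, the holes. So the holes are
-- closed under sums of three, and with four independent holes as a basis of S they are
-- exactly the odd combinations, i.e. S minus the subspace T of even combinations.

module Submission where



open import Defs
open import Algebra.Bundles using (CommutativeRing; CommutativeMonoid)
open import Data.Bool using (Bool; true; false; not; _∧_; _xor_)
open import Data.Bool.Properties
  using ( xor-comm; xor-assoc; xor-same; xor-identityˡ; xor-identityʳ; true-xor
        ; ∧-distribˡ-xor; ∧-distribʳ-xor; ∧-comm; ∧-identityʳ; ∧-zeroʳ; ∧-conicalˡ; ∧-conicalʳ )
import Data.Bool.Properties as Bool
open import Data.Empty using (⊥-elim)
open import Data.Fin using (Fin; zero; suc)
import Data.Fin.Properties as Fin
open import Data.Nat using (ℕ; zero; suc; _+_; _*_; _^_; _≤_; _<_; z≤n; s≤s; _≡ᵇ_)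
open import Data.Nat.Divisibility using (_∣_; divides; ∣m+n∣m⇒∣n; m∣m*n; ∣-trans)
open import Data.Nat.Properties
open import Data.Nat.Tactic.RingSolver using (solve-∀)
open import Data.Product using (Σ; ∃-syntax; _×_; _,_; proj₁; proj₂)
open import Data.Sum using (_⊎_; inj₁; inj₂; [_,_]′)
open import Data.Unit using (tt)
open import Data.Vec using (Vec; []; _∷_; replicate; map)
open import Data.Vec.Properties using (≡-dec; zipWith-comm; zipWith-assoc; zipWith-identityˡ; zipWith-identityʳ)
open import Data.Vec.Relation.Unary.All using (All; []; _∷_)
open import Function using (_∘_)
open import Function.Bundles using (_⇔_; mk⇔; Equivalence)
import Function.Properties.Equivalence as ⇔
open import Relation.Binary.PropositionalEquality
open import Relation.Nullary using (¬_; Dec; does; yes; no)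
open import Relation.Nullary.Decidable using (dec-true; dec-false)
open import Algebra.Properties.Semiring.Sum +-*-semiring using (sum; sum-cong-≗; *-distribˡ-sum)
open import Algebra.Properties.CommutativeSemigroup
  (CommutativeRing.+-commutativeSemigroup Bool.xor-∧-commutativeRing)
  using () renaming (interchange to xor-interchange)
open import Algebra.Properties.CommutativeSemigroup
  (CommutativeMonoid.commutativeSemigroup Bool.∧-commutativeMonoid)
  using () renaming (interchange to ∧-interchange)

⟦_⟧ : Bool → ℕ
⟦ true ⟧ = 1
⟦ false ⟧ = 0

⟦⟧≤1 : ∀ p → ⟦ p ⟧ ≤ 1
⟦⟧≤1 true = s≤s z≤n
⟦⟧≤1 false = z≤n

⟦⟧-pos : ∀ {p} → 0 < ⟦ p ⟧ → p ≡ true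
⟦⟧-pos {true} _ = refl

⟦∧⟧ : ∀ p q → ⟦ p ∧ q ⟧ ≡ ⟦ p ⟧ * ⟦ q ⟧
⟦∧⟧ true q = sym (+-identityʳ ⟦ q ⟧)
⟦∧⟧ false q = refl

⟦xor⟧ : ∀ p q → 2 * ⟦ p ∧ q ⟧ + ⟦ p xor q ⟧ ≡ ⟦ p ⟧ + ⟦ q ⟧
⟦xor⟧ true true = refl
⟦xor⟧ true false = refl
⟦xor⟧ false q = refl

⟦⟧*-cong : ∀ p {x y} → (p ≡ true → x ≡ y) → ⟦ p ⟧ * x ≡ ⟦ p ⟧ * y
⟦⟧*-cong true eq = cong (_+ 0) (eq refl)
⟦⟧*-cong false eq = refl

⟦⟧-split : ∀ p q → ⟦ p ∧ q ⟧ + ⟦ p ∧ not q ⟧ ≡ ⟦ p ⟧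
⟦⟧-split true true = refl
⟦⟧-split true false = refl
⟦⟧-split false q = refl

⟦⟧-mono : ∀ {p q} → (p ≡ true → q ≡ true) → ⟦ p ⟧ ≤ ⟦ q ⟧
⟦⟧-mono {false} _ = z≤n
⟦⟧-mono {true} p⇒q = ≤-reflexive (cong ⟦_⟧ (sym (p⇒q refl)))

≤⟦⟧ : ∀ {x q} → x ≤ 1 → (0 < x → q ≡ true) → x ≤ ⟦ q ⟧
≤⟦⟧ z≤n _ = z≤n
≤⟦⟧ (s≤s z≤n) q≡true = ≤-reflexive (cong ⟦_⟧ (sym (q≡true (s≤s z≤n))))

-- Linear algebra over 𝔽₂

_==_ : ∀ {n} → Vec₂ n → Vec₂ n → Bool
u == v = does (≡-dec Bool._≟_ u v)

==-refl : ∀ {n} (v : Vec₂ n) → (v == v) ≡ true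
==-refl v = dec-true (≡-dec Bool._≟_ v v) refl

==⇒≡ : ∀ {n} {u v : Vec₂ n} → (u == v) ≡ true → u ≡ v
==⇒≡ {u = u} {v} eq with ≡-dec Bool._≟_ u v
... | yes u≡v = u≡v

≢⇒== : ∀ {n} {u v : Vec₂ n} → u ≢ v → (u == v) ≡ false
≢⇒== {u = u} {v} = dec-false (≡-dec Bool._≟_ u v)

==-cong : ∀ {j n} {c d : Vec₂ j} {u v : Vec₂ n} → (c ≡ d → u ≡ v) → (u ≡ v → c ≡ d) → (c == d) ≡ (u == v)
==-cong {c = c} {d} {u} {v} to from with ≡-dec Bool._≟_ c d | ≡-dec Bool._≟_ u v
... | yes c≡d | yes _ = refl
... | yes c≡d | no u≢v = ⊥-elim (u≢v (to c≡d))
... | no c≢d | yes u≡v = ⊥-elim (c≢d (from u≡v))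
... | no _ | no _ = refl

nonzero : ∀ {n} → Vec₂ n → Bool
nonzero v = not (v == zeroV)

nonzero-true : ∀ {n} {v : Vec₂ n} → v ≢ zeroV → nonzero v ≡ true
nonzero-true v≢0 = cong not (≢⇒== v≢0)

nonzero⇒≢ : ∀ {n} {v : Vec₂ n} → nonzero v ≡ true → v ≢ zeroV
nonzero⇒≢ {v = v} nz refl with () ← trans (sym nz) (cong not (==-refl v))

⊕-comm : ∀ {n} (u v : Vec₂ n) → u ⊕ v ≡ v ⊕ u
⊕-comm = zipWith-comm xor-comm

⊕-assoc : ∀ {n} (u v w : Vec₂ n) → (u ⊕ v) ⊕ w ≡ u ⊕ (v ⊕ w)
⊕-assoc = zipWith-assoc xor-assoc

⊕-identityˡ : ∀ {n} (v : Vec₂ n) → zeroV ⊕ v ≡ v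
⊕-identityˡ = zipWith-identityˡ xor-identityˡ

⊕-identityʳ : ∀ {n} (v : Vec₂ n) → v ⊕ zeroV ≡ v
⊕-identityʳ = zipWith-identityʳ xor-identityʳ

⊕-self : ∀ {n} (v : Vec₂ n) → v ⊕ v ≡ zeroV
⊕-self [] = refl
⊕-self (a ∷ v) = cong₂ _∷_ (xor-same a) (⊕-self v)

⊕-cancelʳ : ∀ {n} (u v : Vec₂ n) → (u ⊕ v) ⊕ v ≡ u
⊕-cancelʳ u v = trans (⊕-assoc u v v) (trans (cong (u ⊕_) (⊕-self v)) (⊕-identityʳ u))

⊕≡zero⇒≡ : ∀ {n} {u v : Vec₂ n} → u ⊕ v ≡ zeroV → u ≡ v
⊕≡zero⇒≡ {u = u} {v} eq = trans (sym (⊕-cancelʳ u v)) (trans (cong (_⊕ v) eq) (⊕-identityˡ v))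

⊕-interchange : ∀ {n} (p q r s : Vec₂ n) → (p ⊕ q) ⊕ (r ⊕ s) ≡ (p ⊕ r) ⊕ (q ⊕ s)
⊕-interchange [] [] [] [] = refl
⊕-interchange (a ∷ p) (b ∷ q) (c ∷ r) (d ∷ s) = cong₂ _∷_ (xor-interchange a b c d) (⊕-interchange p q r s)

·-true : ∀ {n} (v : Vec₂ n) → true · v ≡ v
·-true [] = refl
·-true (a ∷ v) = cong (a ∷_) (·-true v)

·-false : ∀ {n} (v : Vec₂ n) → false · v ≡ zeroV
·-false [] = refl
·-false (a ∷ v) = cong (false ∷_) (·-false v)

·-distribʳ-xor : ∀ {n} c d (v : Vec₂ n) → (c xor d) · v ≡ (c · v) ⊕ (d · v)
·-distribʳ-xor c d [] = refl
·-distribʳ-xor c d (a ∷ v) = cong₂ _∷_ (∧-distribʳ-xor a c d) (·-distribʳ-xor c d v)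

dot : ∀ {n} → Vec₂ n → Vec₂ n → Bool
dot [] [] = false
dot (a ∷ u) (b ∷ v) = (a ∧ b) xor dot u v

dot-comm : ∀ {n} (u v : Vec₂ n) → dot u v ≡ dot v u
dot-comm [] [] = refl
dot-comm (a ∷ u) (b ∷ v) = cong₂ _xor_ (∧-comm a b) (dot-comm u v)

dot-zeroʳ : ∀ {n} (u : Vec₂ n) → dot u zeroV ≡ false
dot-zeroʳ [] = refl
dot-zeroʳ (a ∷ u) = trans (cong (_xor dot u zeroV) (∧-zeroʳ a)) (dot-zeroʳ u)

dot-⊕ʳ : ∀ {n} (a u v : Vec₂ n) → dot a (u ⊕ v) ≡ dot a u xor dot a v
dot-⊕ʳ [] [] [] = refl
dot-⊕ʳ (a ∷ as) (b ∷ u) (c ∷ v) =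
  trans (cong₂ _xor_ (∧-distribˡ-xor a b c) (dot-⊕ʳ as u v))
        (xor-interchange (a ∧ b) (a ∧ c) (dot as u) (dot as v))

dot-⊕ˡ : ∀ {n} (u v a : Vec₂ n) → dot (u ⊕ v) a ≡ dot u a xor dot v a
dot-⊕ˡ u v a = trans (dot-comm (u ⊕ v) a)
  (trans (dot-⊕ʳ a u v) (cong₂ _xor_ (dot-comm a u) (dot-comm a v)))

dot-· : ∀ {n} (a : Vec₂ n) c u → dot a (c · u) ≡ c ∧ dot a u
dot-· a true u = cong (dot a) (·-true u)
dot-· a false u = trans (cong (dot a) (·-false u)) (dot-zeroʳ a)

dot-lincomb : ∀ {k n} (a : Vec₂ n) (c : Vec₂ k) (bs : Vec (Vec₂ n) k) →
  dot a (lincomb c bs) ≡ dot c (map (dot a) bs)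
dot-lincomb a [] [] = dot-zeroʳ a
dot-lincomb a (c ∷ cs) (b ∷ bs) =
  trans (dot-⊕ʳ a (c · b) (lincomb cs bs)) (cong₂ _xor_ (dot-· a c b) (dot-lincomb a cs bs))

lincomb-zero : ∀ {k n} (bs : Vec (Vec₂ n) k) → lincomb zeroV bs ≡ zeroV
lincomb-zero [] = refl
lincomb-zero (b ∷ bs) = trans (cong₂ _⊕_ (·-false b) (lincomb-zero bs)) (⊕-identityˡ zeroV)

lincomb-⊕ : ∀ {k n} (c d : Vec₂ k) (bs : Vec (Vec₂ n) k) →
  lincomb (c ⊕ d) bs ≡ lincomb c bs ⊕ lincomb d bs
lincomb-⊕ [] [] [] = sym (⊕-identityˡ zeroV)
lincomb-⊕ (c ∷ cs) (d ∷ ds) (b ∷ bs) =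
  trans (cong₂ _⊕_ (·-distribʳ-xor c d b) (lincomb-⊕ cs ds bs))
        (⊕-interchange (c · b) (d · b) (lincomb cs bs) (lincomb ds bs))

lincomb-· : ∀ {k n} c (d : Vec₂ k) (bs : Vec (Vec₂ n) k) → lincomb (c · d) bs ≡ c · lincomb d bs
lincomb-· true d bs = trans (cong (λ x → lincomb x bs) (·-true d)) (sym (·-true _))
lincomb-· false d bs =
  trans (cong (λ x → lincomb x bs) (·-false d)) (trans (lincomb-zero bs) (sym (·-false _)))

lincomb-map : ∀ {j k n} (c : Vec₂ j) (ds : Vec (Vec₂ k) j) (bs : Vec (Vec₂ n) k) →
  lincomb c (map (λ d → lincomb d bs) ds) ≡ lincomb (lincomb c ds) bs
lincomb-map [] [] bs = sym (lincomb-zero bs)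
lincomb-map (c ∷ cs) (d ∷ ds) bs =
  trans (cong₂ _⊕_ (sym (lincomb-· c d bs)) (lincomb-map cs ds bs))
        (sym (lincomb-⊕ (c · d) (lincomb cs ds) bs))

lincomb-injective : ∀ {k n} {bs : Vec (Vec₂ n) k} → LinIndep bs →
  ∀ {c d} → lincomb c bs ≡ lincomb d bs → c ≡ d
lincomb-injective {bs = bs} indep {c} {d} eq = ⊕≡zero⇒≡ (indep (c ⊕ d)
  (trans (lincomb-⊕ c d bs) (trans (cong (_⊕ lincomb d bs) eq) (⊕-self _))))

nonzero-lincomb : ∀ {k n} {bs : Vec (Vec₂ n) k} → LinIndep bs → ∀ c → nonzero (lincomb c bs) ≡ nonzero c
nonzero-lincomb {bs = bs} indep c =
  cong not (==-cong (indep c) (λ c≡0 → trans (cong (λ c → lincomb c bs) c≡0) (lincomb-zero bs)))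

lincomb-false∷ : ∀ {k n} (c : Vec₂ k) x (xs : Vec (Vec₂ n) k) → lincomb (false ∷ c) (x ∷ xs) ≡ lincomb c xs
lincomb-false∷ c x xs = trans (cong (_⊕ lincomb c xs) (·-false x)) (⊕-identityˡ _)

lincomb-true∷ : ∀ {k n} (c : Vec₂ k) x (xs : Vec (Vec₂ n) k) → lincomb (true ∷ c) (x ∷ xs) ≡ x ⊕ lincomb c xs
lincomb-true∷ c x xs = cong (_⊕ lincomb c xs) (·-true x)

LinIndep-[] : ∀ {n} → LinIndep {0} {n} []
LinIndep-[] [] _ = refl

LinIndep-∷ : ∀ {k n} {x} {xs : Vec (Vec₂ n) k} → LinIndep xs → (∀ c → lincomb c xs ≢ x) → LinIndep (x ∷ xs)
LinIndep-∷ {x = x} {xs} indep x∉ (false ∷ c) eq = cong (false ∷_) (indep c (trans (sym (lincomb-false∷ c x xs)) eq))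
LinIndep-∷ {x = x} {xs} indep x∉ (true ∷ c) eq =
  ⊥-elim (x∉ c (sym (⊕≡zero⇒≡ (trans (sym (lincomb-true∷ c x xs)) eq))))

parity : ∀ {k} → Vec₂ k → Bool
parity c = dot c (replicate _ true)

-- Sums over 𝔽₂ⁿ

+-tight : ∀ {a b c d} → a ≤ c → b ≤ d → a + b ≡ c + d → a ≡ c × b ≡ d
+-tight {a} {b} {c} {d} a≤c b≤d eq with m≤n⇒m<n∨m≡n a≤c
... | inj₂ refl = refl , +-cancelˡ-≡ a b d eq
... | inj₁ a<c  = ⊥-elim (<⇒≢ (+-mono-<-≤ a<c b≤d) eq)

-- Opaque, so that sums over 𝔽₂⁷ are never unfolded into 128 summands during type checking.
opaque

  sumV : ∀ n → (Vec₂ n → ℕ) → ℕ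
  sumV zero f = f []
  sumV (suc n) f = sumV n (λ v → f (false ∷ v)) + sumV n (λ v → f (true ∷ v))

  sumV-cong : ∀ {n} {f g : Vec₂ n → ℕ} → (∀ v → f v ≡ g v) → sumV n f ≡ sumV n g
  sumV-cong {zero} eq = eq []
  sumV-cong {suc n} eq = cong₂ _+_ (sumV-cong (eq ∘ (false ∷_))) (sumV-cong (eq ∘ (true ∷_)))

  sumV-const : ∀ n k → sumV n (λ _ → k) ≡ 2 ^ n * k
  sumV-const zero k = sym (+-identityʳ k)
  sumV-const (suc n) k = begin
    sumV n (λ _ → k) + sumV n (λ _ → k) ≡⟨ cong₂ _+_ (sumV-const n k) (sumV-const n k) ⟩
    2 ^ n * k + 2 ^ n * k               ≡⟨ double (2 ^ n) k ⟩
    2 ^ suc n * k                       ∎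
    where
    open ≡-Reasoning
    double : ∀ a k → a * k + a * k ≡ (2 * a) * k
    double = solve-∀

  sumV-distrib-+ : ∀ {n} (f g : Vec₂ n → ℕ) → sumV n (λ v → f v + g v) ≡ sumV n f + sumV n g
  sumV-distrib-+ {zero} f g = refl
  sumV-distrib-+ {suc n} f g = begin
    sumV n (λ v → f (false ∷ v) + g (false ∷ v)) + sumV n (λ v → f (true ∷ v) + g (true ∷ v))
      ≡⟨ cong₂ _+_ (sumV-distrib-+ (λ v → f (false ∷ v)) (λ v → g (false ∷ v)))
                   (sumV-distrib-+ (λ v → f (true ∷ v)) (λ v → g (true ∷ v))) ⟩
    (F₀ + G₀) + (F₁ + G₁) ≡⟨ +-shuffle F₀ G₀ F₁ G₁ ⟩
    (F₀ + F₁) + (G₀ + G₁) ∎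
    where
    open ≡-Reasoning
    F₀ : ℕ
    F₀ = sumV n (λ v → f (false ∷ v))
    F₁ : ℕ
    F₁ = sumV n (λ v → f (true ∷ v))
    G₀ : ℕ
    G₀ = sumV n (λ v → g (false ∷ v))
    G₁ : ℕ
    G₁ = sumV n (λ v → g (true ∷ v))
    +-shuffle : ∀ a b c d → (a + b) + (c + d) ≡ (a + c) + (b + d)
    +-shuffle = solve-∀

  sumV-*ˡ : ∀ {n} k (f : Vec₂ n → ℕ) → sumV n (λ v → k * f v) ≡ k * sumV n f
  sumV-*ˡ {zero} k f = refl
  sumV-*ˡ {suc n} k f =
    trans (cong₂ _+_ (sumV-*ˡ k (λ v → f (false ∷ v))) (sumV-*ˡ k (λ v → f (true ∷ v)))) (sym (*-distribˡ-+ k _ _))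

  sumV-*ʳ : ∀ {n} k (f : Vec₂ n → ℕ) → sumV n (λ v → f v * k) ≡ sumV n f * k
  sumV-*ʳ {n} k f = trans (sumV-cong (λ v → *-comm (f v) k)) (trans (sumV-*ˡ k f) (*-comm k _))

  sumV-zero : ∀ n → sumV n (λ _ → 0) ≡ 0
  sumV-zero n = trans (sumV-const n 0) (*-zeroʳ (2 ^ n))

  sumV-mono-≤ : ∀ {n} {f g : Vec₂ n → ℕ} → (∀ v → f v ≤ g v) → sumV n f ≤ sumV n g
  sumV-mono-≤ {zero} le = le []
  sumV-mono-≤ {suc n} le = +-mono-≤ (sumV-mono-≤ (le ∘ (false ∷_))) (sumV-mono-≤ (le ∘ (true ∷_)))

  sumV-comm : ∀ m n (f : Vec₂ m → Vec₂ n → ℕ) →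
    sumV m (λ u → sumV n (λ v → f u v)) ≡ sumV n (λ v → sumV m (λ u → f u v))
  sumV-comm zero n f = refl
  sumV-comm (suc m) n f =
    trans (cong₂ _+_ (sumV-comm m n (λ u → f (false ∷ u))) (sumV-comm m n (λ u → f (true ∷ u))))
          (sym (sumV-distrib-+ (λ v → sumV m (λ u → f (false ∷ u) v)) (λ v → sumV m (λ u → f (true ∷ u) v))))

  sumV-translate : ∀ {n} (b : Vec₂ n) (f : Vec₂ n → ℕ) → sumV n (λ v → f (v ⊕ b)) ≡ sumV n f
  sumV-translate {zero} [] f = refl
  sumV-translate {suc n} (false ∷ b) f =
    cong₂ _+_ (sumV-translate b (λ v → f (false ∷ v))) (sumV-translate b (λ v → f (true ∷ v)))
  sumV-translate {suc n} (true ∷ b) f =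
    trans (cong₂ _+_ (sumV-translate b (λ v → f (true ∷ v))) (sumV-translate b (λ v → f (false ∷ v))))
          (+-comm (sumV n (λ v → f (true ∷ v))) (sumV n (λ v → f (false ∷ v))))

  sumV-witness : ∀ {n} (f : Vec₂ n → ℕ) → 0 < sumV n f → ∃[ v ] 0 < f v
  sumV-witness {zero} f pos = [] , pos
  sumV-witness {suc n} f pos with sumV n (λ v → f (false ∷ v)) in eq
  ... | suc _ = let v , fv>0 = sumV-witness _ (subst (0 <_) (sym eq) (s≤s z≤n)) in false ∷ v , fv>0
  ... | zero  = let v , fv>0 = sumV-witness _ pos in true ∷ v , fv>0

  sumV-<⇒∃ : ∀ {n} {f g : Vec₂ n → ℕ} → sumV n f < sumV n g → ∃[ v ] f v < g v
  sumV-<⇒∃ {zero} lt = [] , lt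
  sumV-<⇒∃ {suc n} {f} {g} lt with sumV n (λ v → f (false ∷ v)) <? sumV n (λ v → g (false ∷ v))
  ... | yes lt₀ = let v , fv<gv = sumV-<⇒∃ lt₀ in false ∷ v , fv<gv
  ... | no ≮₀ = let v , fv<gv = sumV-<⇒∃ lt₁ in true ∷ v , fv<gv
    where
    lt₁ : sumV n (λ v → f (true ∷ v)) < sumV n (λ v → g (true ∷ v))
    lt₁ = +-cancelˡ-< (sumV n (λ v → g (false ∷ v))) _ _
            (≤-<-trans (+-monoˡ-≤ _ (≮⇒≥ ≮₀)) lt)

  sumV-tight : ∀ {n} {f g : Vec₂ n → ℕ} → (∀ v → f v ≤ g v) → sumV n f ≡ sumV n g → ∀ v → f v ≡ g v
  sumV-tight {zero} le eq [] = eq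
  sumV-tight {suc n} le eq (b ∷ v)
    with +-tight (sumV-mono-≤ (le ∘ (false ∷_))) (sumV-mono-≤ (le ∘ (true ∷_))) eq
  sumV-tight {suc n} le eq (false ∷ v) | eq₀ , _ = sumV-tight (le ∘ (false ∷_)) eq₀ v
  sumV-tight {suc n} le eq (true ∷ v)  | _ , eq₁ = sumV-tight (le ∘ (true ∷_)) eq₁ v

  sumV-term : ∀ {n} (f : Vec₂ n → ℕ) v → f v ≤ sumV n f
  sumV-term f [] = ≤-refl
  sumV-term {suc n} f (false ∷ v) = ≤-trans (sumV-term (λ v → f (false ∷ v)) v) (m≤m+n _ _)
  sumV-term {suc n} f (true ∷ v) = ≤-trans (sumV-term (λ v → f (true ∷ v)) v) (m≤n+m _ _)

  sumV-delta : ∀ {n} (w : Vec₂ n) (g : Vec₂ n → ℕ) → sumV n (λ v → ⟦ w == v ⟧ * g v) ≡ g w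
  sumV-delta {zero} [] g = +-identityʳ (g [])
  sumV-delta {suc n} (false ∷ w) g =
    trans (cong₂ _+_ (sumV-delta w (λ v → g (false ∷ v))) (sumV-zero n)) (+-identityʳ _)
  sumV-delta {suc n} (true ∷ w) g = cong₂ _+_ (sumV-zero n) (sumV-delta w (λ v → g (true ∷ v)))

count : ∀ n → (Vec₂ n → Bool) → ℕ
count n p = sumV n (λ v → ⟦ p v ⟧)

count-split : ∀ {n} (p q : Vec₂ n → Bool) →
  count n (λ a → p a ∧ q a) + count n (λ a → p a ∧ not (q a)) ≡ count n p
count-split p q = trans (sym (sumV-distrib-+ (λ a → ⟦ p a ∧ q a ⟧) (λ a → ⟦ p a ∧ not (q a) ⟧)))
                        (sumV-cong (λ a → ⟦⟧-split (p a) (q a)))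

count-witness : ∀ {n} (p : Vec₂ n → Bool) → 0 < count n p → ∃[ v ] p v ≡ true
count-witness p pos = let v , pv = sumV-witness (λ v → ⟦ p v ⟧) pos in v , ⟦⟧-pos pv

count-pos : ∀ {n} (p : Vec₂ n → Bool) v → p v ≡ true → 0 < count n p
count-pos p v pv = ≤-trans (≤-reflexive (cong ⟦_⟧ (sym pv))) (sumV-term (λ v → ⟦ p v ⟧) v)

count-mono : ∀ {n} {p q : Vec₂ n → Bool} → (∀ v → p v ≡ true → q v ≡ true) → count n p ≤ count n q
count-mono p⊆q = sumV-mono-≤ (λ v → ⟦⟧-mono (p⊆q v))

count-⊆-≡⇒⊇ : ∀ {n} {p q : Vec₂ n → Bool} → (∀ v → p v ≡ true → q v ≡ true) →
  count n p ≡ count n q → ∀ v → q v ≡ true → p v ≡ true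
count-⊆-≡⇒⊇ {p = p} {q} p⊆q eq v qv = ⟦⟧-pos (subst (0 <_) (trans (cong ⟦_⟧ (sym qv)) (sym pointwise)) (s≤s z≤n))
  where
  pointwise : ⟦ p v ⟧ ≡ ⟦ q v ⟧
  pointwise = sumV-tight (λ v → ⟦⟧-mono (p⊆q v)) eq v

count-zero⇒false : ∀ {n} (p : Vec₂ n → Bool) → count n p ≡ 0 → ∀ v → p v ≡ false
count-zero⇒false {n} p eq v
  with p v | sumV-tight {g = λ v → ⟦ p v ⟧} (λ _ → z≤n) (trans (sumV-zero n) (sym eq)) v
... | false | _ = refl
... | true | ()

count-false : ∀ {n} (p : Vec₂ n → Bool) → (∀ v → p v ≡ false) → count n p ≡ 0
count-false {n} p p≡false = trans (sumV-cong (λ v → cong ⟦_⟧ (p≡false v))) (sumV-zero n)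

count-== : ∀ {n} (w : Vec₂ n) → count n (w ==_) ≡ 1
count-== w = trans (sumV-cong (λ v → sym (*-identityʳ ⟦ w == v ⟧))) (sumV-delta w (λ _ → 1))

count-∧ˡ : ∀ {n} p (q : Vec₂ n → Bool) → count n (λ a → p ∧ q a) ≡ ⟦ p ⟧ * count n q
count-∧ˡ p q = trans (sumV-cong (λ a → ⟦∧⟧ p (q a))) (sumV-*ˡ ⟦ p ⟧ (λ a → ⟦ q a ⟧))

sumV-*-sumV : ∀ {n} (f g : Vec₂ n → ℕ) → sumV n f * sumV n g ≡ sumV n (λ u → sumV n (λ v → f u * g v))
sumV-*-sumV f g = trans (sym (sumV-*ʳ _ f)) (sumV-cong (λ u → sym (sumV-*ˡ (f u) g)))

count-∧-== : ∀ {n} (p : Vec₂ n → Bool) w → count n (λ a → p a ∧ (a == w)) ≡ ⟦ p w ⟧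
count-∧-== p w = trans (sumV-cong pointwise) (sumV-delta w (λ a → ⟦ p a ⟧))
  where
  pointwise : ∀ a → ⟦ p a ∧ (a == w) ⟧ ≡ ⟦ w == a ⟧ * ⟦ p a ⟧
  pointwise a = trans (⟦∧⟧ (p a) _)
    (trans (*-comm ⟦ p a ⟧ _) (cong (λ b → ⟦ b ⟧ * ⟦ p a ⟧) (==-cong {c = a} {w} {w} {a} sym sym)))

count-∧≡0⇔ : ∀ {n} (p q : Vec₂ n → Bool) →
  (count n (λ a → p a ∧ q a) ≡ᵇ 0) ≡ true ⇔ (∀ a → p a ≡ true → q a ≡ false)
count-∧≡0⇔ {n} p q = mk⇔ to from
  where
  to : (count n (λ a → p a ∧ q a) ≡ᵇ 0) ≡ true → ∀ a → p a ≡ true → q a ≡ false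
  to eq a pa = subst (λ b → b ∧ q a ≡ false) pa
    (count-zero⇒false _ (≡ᵇ⇒≡ _ 0 (Bool.T-≡ .Equivalence.from eq)) a)
  from : (∀ a → p a ≡ true → q a ≡ false) → (count n (λ a → p a ∧ q a) ≡ᵇ 0) ≡ true
  from p⇒¬q = cong (_≡ᵇ 0) (count-false _ pointwise)
    where
    pointwise : ∀ a → p a ∧ q a ≡ false
    pointwise a with p a in pa
    ... | true = p⇒¬q a pa
    ... | false = refl

sumV-pushforward : ∀ {j n} (g : Vec₂ j → Vec₂ n) (φ : Vec₂ n → ℕ) →
  sumV n (λ v → φ v * count j (λ c → g c == v)) ≡ sumV j (φ ∘ g)
sumV-pushforward {j} {n} g φ = begin
  sumV n (λ v → φ v * count j (λ c → g c == v))
    ≡⟨ sumV-cong (λ v → trans (*-comm (φ v) _) (sym (sumV-*ʳ (φ v) (λ c → ⟦ g c == v ⟧)))) ⟩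
  sumV n (λ v → sumV j (λ c → ⟦ g c == v ⟧ * φ v))    ≡⟨ sumV-comm n j _ ⟩
  sumV j (λ c → sumV n (λ v → ⟦ g c == v ⟧ * φ v))    ≡⟨ sumV-cong (λ c → sumV-delta (g c) φ) ⟩
  sumV j (φ ∘ g)                                      ∎
  where open ≡-Reasoning

count-fibre-injective : ∀ {j n} (g : Vec₂ j → Vec₂ n) → (∀ {c d} → g c ≡ g d → c ≡ d) →
  ∀ v → count j (λ c → g c == v) ≤ 1
count-fibre-injective {j} g inj v with count j (λ c → g c == v) in eq
... | zero = z≤n
... | suc _ =
  let c₀ , gc₀==v = count-witness (λ c → g c == v) (subst (0 <_) (sym eq) (s≤s z≤n))
  in ≤-reflexive (trans (sym eq) (trans (sumV-cong (fibre≡ c₀ (==⇒≡ gc₀==v))) (count-== c₀)))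
  where
  fibre≡ : ∀ c₀ → g c₀ ≡ v → ∀ c → ⟦ g c == v ⟧ ≡ ⟦ c₀ == c ⟧
  fibre≡ c₀ gc₀≡v c = cong ⟦_⟧ (==-cong (λ gc≡v → sym (inj (trans gc≡v (sym gc₀≡v))))
                                        (λ c₀≡c → trans (cong g (sym c₀≡c)) gc₀≡v))

sumV-count-fibres : ∀ {j n} (g : Vec₂ j → Vec₂ n) (p : Vec₂ j → Bool) →
  sumV n (λ v → count j (λ c → p c ∧ (g c == v))) ≡ count j p
sumV-count-fibres {j} {n} g p = begin
  sumV n (λ v → count j (λ c → p c ∧ (g c == v)))      ≡⟨ sumV-cong (λ v → sumV-cong (λ c → ⟦∧⟧ (p c) (g c == v))) ⟩
  sumV n (λ v → sumV j (λ c → ⟦ p c ⟧ * ⟦ g c == v ⟧)) ≡⟨ sumV-comm n j _ ⟩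
  sumV j (λ c → sumV n (λ v → ⟦ p c ⟧ * ⟦ g c == v ⟧))
    ≡⟨ sumV-cong (λ c → sumV-*ˡ ⟦ p c ⟧ (λ v → ⟦ g c == v ⟧)) ⟩
  sumV j (λ c → ⟦ p c ⟧ * count n (g c ==_))
    ≡⟨ sumV-cong (λ c → trans (cong (⟦ p c ⟧ *_) (count-== (g c))) (*-identityʳ _)) ⟩
  count j p                                            ∎
  where open ≡-Reasoning

count-image : ∀ {j n} (g : Vec₂ j → Vec₂ n) → (∀ {c d} → g c ≡ g d → c ≡ d) →
  (p : Vec₂ j → Bool) (q : Vec₂ n → Bool) → (∀ c → p c ≡ true → q (g c) ≡ true) →
  count j p ≡ count n q → ∀ v → q v ≡ true → ∃[ c ] p c ≡ true × g c ≡ v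
count-image {j} {n} g inj p q g[p]⊆q eq v qv =
  let c , pc∧gc≡v = count-witness (λ c → p c ∧ (g c == v)) hit>0
  in c , ∧-conicalˡ _ _ pc∧gc≡v , ==⇒≡ (∧-conicalʳ _ _ pc∧gc≡v)
  where
  hits : Vec₂ n → ℕ
  hits u = count j (λ c → p c ∧ (g c == u))
  hits≤q : ∀ u → hits u ≤ ⟦ q u ⟧
  hits≤q u = ≤⟦⟧ (≤-trans (count-mono (λ c → ∧-conicalʳ (p c) _)) (count-fibre-injective g inj u))
    λ pos → let c , pc∧gc≡u = count-witness _ pos
            in subst (λ u → q u ≡ true) (==⇒≡ (∧-conicalʳ _ _ pc∧gc≡u)) (g[p]⊆q c (∧-conicalˡ _ _ pc∧gc≡u))
  hit>0 : 0 < hits v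
  hit>0 = subst (0 <_) (trans (cong ⟦_⟧ (sym qv)) (sym (sumV-tight hits≤q (trans (sumV-count-fibres g p) eq) v))) (s≤s z≤n)

count-all : ∀ n → count n (λ _ → true) ≡ 2 ^ n
count-all n = trans (sumV-const n 1) (*-identityʳ (2 ^ n))

count-nonzero : ∀ n → 1 + count n nonzero ≡ 2 ^ n
count-nonzero n = trans (cong (_+ count n nonzero) (sym (count-∧-== {n} (λ _ → true) zeroV)))
                        (trans (count-split (λ _ → true) (_== zeroV)) (count-all n))

-- Character sums

opaque
  unfolding sumV
  count-dot : ∀ {n} (v : Vec₂ n) → 2 * count n (λ a → dot a v) ≡ 2 ^ n * ⟦ nonzero v ⟧
  count-dot [] = refl
  count-dot {suc n} (false ∷ v) = begin
    2 * (X + X)               ≡⟨ double X ⟩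
    2 * (2 * X)               ≡⟨ cong (2 *_) (count-dot v) ⟩
    2 * (2 ^ n * ⟦ nonzero v ⟧) ≡⟨ sym (*-assoc 2 (2 ^ n) _) ⟩
    2 ^ suc n * ⟦ nonzero v ⟧   ∎
    where
    open ≡-Reasoning
    X : ℕ
    X = count n (λ a → dot a v)
    double : ∀ x → 2 * (x + x) ≡ 2 * (2 * x)
    double = solve-∀
  count-dot {suc n} (true ∷ v) = begin
    2 * (count n (λ a → dot a v) + count n (λ a → not (dot a v))) ≡⟨ cong (2 *_) (count-split (λ _ → true) (λ a → dot a v)) ⟩
    2 * count n (λ _ → true)                                       ≡⟨ cong (2 *_) (count-all n) ⟩
    2 * 2 ^ n                                                      ≡⟨ sym (*-identityʳ _) ⟩
    2 ^ suc n * 1                                                  ∎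
    where open ≡-Reasoning

count-dotˡ : ∀ {n} (a : Vec₂ n) → 2 * count n (dot a) ≡ 2 ^ n * ⟦ nonzero a ⟧
count-dotˡ a = trans (cong (2 *_) (sumV-cong (λ v → cong ⟦_⟧ (dot-comm a v)))) (count-dot a)

count-dot-nonzero : ∀ {n} {v : Vec₂ n} → v ≢ zeroV → 2 * count n (λ a → dot a v) ≡ 2 ^ n
count-dot-nonzero {n} {v} v≢0 =
  trans (count-dot v) (trans (cong (λ b → 2 ^ n * ⟦ b ⟧) (nonzero-true v≢0)) (*-identityʳ _))

count-dot-zero : ∀ n → count n (λ a → dot a zeroV) ≡ 0
count-dot-zero n = count-false {n} _ dot-zeroʳ

count-dot-⊕ : ∀ {n} (u v : Vec₂ n) →
  2 * count n (λ a → dot a u ∧ dot a v) + count n (λ a → dot a (u ⊕ v))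
    ≡ count n (λ a → dot a u) + count n (λ a → dot a v)
count-dot-⊕ {n} u v = begin
  2 * count n (λ a → dot a u ∧ dot a v) + count n (λ a → dot a (u ⊕ v))
    ≡⟨ cong₂ _+_ (sym (sumV-*ˡ 2 (λ a → ⟦ dot a u ∧ dot a v ⟧)))
                 (sumV-cong (λ a → cong ⟦_⟧ (dot-⊕ʳ a u v))) ⟩
  sumV n (λ a → 2 * ⟦ dot a u ∧ dot a v ⟧) + sumV n (λ a → ⟦ dot a u xor dot a v ⟧)
    ≡⟨ sym (sumV-distrib-+ (λ a → 2 * ⟦ dot a u ∧ dot a v ⟧) (λ a → ⟦ dot a u xor dot a v ⟧)) ⟩
  sumV n (λ a → 2 * ⟦ dot a u ∧ dot a v ⟧ + ⟦ dot a u xor dot a v ⟧)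
    ≡⟨ sumV-cong (λ a → ⟦xor⟧ (dot a u) (dot a v)) ⟩
  sumV n (λ a → ⟦ dot a u ⟧ + ⟦ dot a v ⟧)
    ≡⟨ sumV-distrib-+ (λ a → ⟦ dot a u ⟧) (λ a → ⟦ dot a v ⟧) ⟩
  count n (λ a → dot a u) + count n (λ a → dot a v) ∎
  where open ≡-Reasoning

count-dot-dot : ∀ {n} {u v : Vec₂ n} → u ≢ zeroV → v ≢ zeroV →
  4 * count n (λ a → dot a u ∧ dot a v) ≡ 2 ^ n + 2 ^ n * ⟦ u == v ⟧
count-dot-dot {n} {u} {v} u≢0 v≢0 = +-cancelʳ-≡ (2 * X) _ _ (trans 4P+2X (sym rhs+2X))
  where
  open ≡-Reasoning
  P : ℕ
  P = count n (λ a → dot a u ∧ dot a v)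
  X : ℕ
  X = count n (λ a → dot a (u ⊕ v))
  4P+2X : 4 * P + 2 * X ≡ 2 ^ n + 2 ^ n
  4P+2X = begin
    4 * P + 2 * X   ≡⟨ factor P X ⟩
    2 * (2 * P + X) ≡⟨ cong (2 *_) (count-dot-⊕ u v) ⟩
    2 * (count n (λ a → dot a u) + count n (λ a → dot a v))
      ≡⟨ *-distribˡ-+ 2 (count n (λ a → dot a u)) _ ⟩
    2 * count n (λ a → dot a u) + 2 * count n (λ a → dot a v)
      ≡⟨ cong₂ _+_ (count-dot-nonzero u≢0) (count-dot-nonzero v≢0) ⟩
    2 ^ n + 2 ^ n   ∎
    where
    factor : ∀ p x → 4 * p + 2 * x ≡ 2 * (2 * p + x)
    factor = solve-∀
  rhs+2X : 2 ^ n + 2 ^ n * ⟦ u == v ⟧ + 2 * X ≡ 2 ^ n + 2 ^ n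
  rhs+2X with ≡-dec Bool._≟_ u v
  ... | yes refl = begin
    2 ^ n + 2 ^ n * 1 + 2 * X ≡⟨ cong (λ w → 2 ^ n + 2 ^ n * 1 + 2 * count n (λ a → dot a w)) (⊕-self u) ⟩
    2 ^ n + 2 ^ n * 1 + 2 * count n (λ a → dot a zeroV) ≡⟨ cong (λ x → 2 ^ n + 2 ^ n * 1 + 2 * x) (count-dot-zero n) ⟩
    2 ^ n + 2 ^ n * 1 + 0 ≡⟨ simplify (2 ^ n) ⟩
    2 ^ n + 2 ^ n ∎
    where
    simplify : ∀ a → a + a * 1 + 2 * 0 ≡ a + a
    simplify = solve-∀
  ... | no u≢v = begin
    2 ^ n + 2 ^ n * 0 + 2 * X ≡⟨ cong (2 ^ n + 2 ^ n * 0 +_) (count-dot-nonzero (u≢v ∘ ⊕≡zero⇒≡)) ⟩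
    2 ^ n + 2 ^ n * 0 + 2 ^ n ≡⟨ simplify (2 ^ n) ⟩
    2 ^ n + 2 ^ n ∎
    where
    simplify : ∀ a → a + a * 0 + a ≡ a + a
    simplify = solve-∀

-- Translating by an element c of Z with c · v = 1 swaps the two fibres of a ↦ a · v on Z.
count-dot-closed : ∀ {n} (Z : Vec₂ n → Bool) → (∀ a b → Z a ≡ true → Z b ≡ true → Z (a ⊕ b) ≡ true) →
  ∀ v → count n (λ a → Z a ∧ dot a v) ≡ 0 ⊎ 2 * count n (λ a → Z a ∧ dot a v) ≡ count n Z
count-dot-closed {n} Z closed v with count n (λ a → Z a ∧ dot a v) in eq
... | zero = inj₁ refl
... | suc _ =
  let c , Zc∧cv = count-witness (λ a → Z a ∧ dot a v) (subst (0 <_) (sym eq) (s≤s z≤n))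
  in inj₂ (trans (cong (2 *_) (sym eq)) (balanced c (∧-conicalˡ _ _ Zc∧cv) (∧-conicalʳ _ _ Zc∧cv)))
  where
  N : ℕ
  N = count n (λ a → Z a ∧ dot a v)
  balanced : ∀ c → Z c ≡ true → dot c v ≡ true → 2 * N ≡ count n Z
  balanced c Zc cv = begin
    2 * N                                            ≡⟨ cong (N +_) (+-identityʳ N) ⟩
    N + N                                            ≡⟨ cong (N +_) (sym (sumV-translate c (λ a → ⟦ Z a ∧ dot a v ⟧))) ⟩
    N + sumV n (λ a → ⟦ Z (a ⊕ c) ∧ dot (a ⊕ c) v ⟧)
      ≡⟨ cong (N +_) (sumV-cong (λ a → cong ⟦_⟧ (cong₂ _∧_ (Z-translate a) (dot-translate a)))) ⟩
    N + count n (λ a → Z a ∧ not (dot a v))          ≡⟨ count-split Z (λ a → dot a v) ⟩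
    count n Z                                        ∎
    where
    open ≡-Reasoning
    Z-translate : ∀ a → Z (a ⊕ c) ≡ Z a
    Z-translate a = Bool.⇔→≡ (mk⇔ (λ Za⊕c → trans (cong Z (sym (⊕-cancelʳ a c))) (closed _ _ Za⊕c Zc))
                                  (λ Za → closed _ _ Za Zc))
    dot-translate : ∀ a → dot (a ⊕ c) v ≡ not (dot a v)
    dot-translate a = trans (dot-⊕ˡ a c v) (trans (cong (dot a v xor_) cv) (trans (xor-comm _ true) (true-xor _)))

-- Partial spreads

sum≡0⇒ : ∀ {m} (f : Fin m → ℕ) → sum f ≡ 0 → ∀ i → f i ≡ 0
sum≡0⇒ f eq zero = m+n≡0⇒m≡0 (f zero) eq
sum≡0⇒ f eq (suc i) = sum≡0⇒ (f ∘ suc) (m+n≡0⇒n≡0 (f zero) eq) i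

sum-zero : ∀ {m} (f : Fin m → ℕ) → (∀ i → f i ≡ 0) → sum f ≡ 0
sum-zero {zero} f f≡0 = refl
sum-zero {suc m} f f≡0 = cong₂ _+_ (f≡0 zero) (sum-zero (f ∘ suc) (f≡0 ∘ suc))

sum-≤1 : ∀ {m} (f : Fin m → ℕ) → (∀ i → f i ≤ 1) → (∀ i j → 0 < f i → 0 < f j → i ≡ j) → sum f ≤ 1
sum-≤1 {zero} f f≤1 unique = z≤n
sum-≤1 {suc m} f f≤1 unique with f zero in f₀
... | zero = sum-≤1 (f ∘ suc) (f≤1 ∘ suc) (λ i j fi>0 fj>0 → Fin.suc-injective (unique _ _ fi>0 fj>0))
... | suc j = subst (λ x → suc j + x ≤ 1) (sym (sum-zero (f ∘ suc) tail≡0))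
                    (subst (_≤ 1) (trans f₀ (sym (+-identityʳ (suc j)))) (f≤1 zero))
  where
  tail≡0 : ∀ i → f (suc i) ≡ 0
  tail≡0 i with f (suc i) in fᵢ
  ... | zero = refl
  ... | suc _ with () ← unique zero (suc i) (subst (0 <_) (sym f₀) (s≤s z≤n)) (subst (0 <_) (sym fᵢ) (s≤s z≤n))

sumV-sum-comm : ∀ {n} m (f : Fin m → Vec₂ n → ℕ) →
  sumV n (λ v → sum (λ i → f i v)) ≡ sum (λ i → sumV n (f i))
sumV-sum-comm {n} zero f = sumV-zero n
sumV-sum-comm {n} (suc m) f =
  trans (sumV-distrib-+ (f zero) (λ v → sum (λ i → f (suc i) v)))
        (cong (sumV n (f zero) +_) (sumV-sum-comm m (f ∘ suc)))

module PartialSpread {n k m : ℕ} (B : Fin m → Subspace n k)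
  (disjoint : ∀ i j → i ≢ j → ∀ v → v ∈ₛ B i → v ∈ₛ B j → v ≡ zeroV) where

  multiplicity : Fin m → Vec₂ n → ℕ
  multiplicity i v = count k (λ c → lincomb c (basis (B i)) == v)

  covering : Vec₂ n → ℕ
  covering v = sum (λ i → multiplicity i v)

  isHole : Vec₂ n → Bool
  isHole v = nonzero v ∧ (covering v ≡ᵇ 0)

  multiplicity≤1 : ∀ i v → multiplicity i v ≤ 1
  multiplicity≤1 i = count-fibre-injective (λ c → lincomb c (basis (B i))) (lincomb-injective (indep (B i)))

  ∈⇒multiplicity>0 : ∀ i v → v ∈ₛ B i → 0 < multiplicity i v
  ∈⇒multiplicity>0 i v (c , c∈) = count-pos (λ c → lincomb c (basis (B i)) == v) c (trans (cong (_== v) c∈) (==-refl v))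

  multiplicity>0⇒∈ : ∀ i v → 0 < multiplicity i v → v ∈ₛ B i
  multiplicity>0⇒∈ i v pos = let c , c== = count-witness _ pos in c , ==⇒≡ c==

  covering≤1 : ∀ v → v ≢ zeroV → covering v ≤ 1
  covering≤1 v v≢0 = sum-≤1 (λ i → multiplicity i v) (λ i → multiplicity≤1 i v) unique
    where
    unique : ∀ i j → 0 < multiplicity i v → 0 < multiplicity j v → i ≡ j
    unique i j vᵢ vⱼ with i Fin.≟ j
    ... | yes i≡j = i≡j
    ... | no i≢j = ⊥-elim (v≢0 (disjoint i j i≢j v (multiplicity>0⇒∈ i v vᵢ) (multiplicity>0⇒∈ j v vⱼ)))

  hole+covering : ∀ v → v ≢ zeroV → ⟦ isHole v ⟧ + covering v ≡ 1
  hole+covering v v≢0 rewrite nonzero-true v≢0 with covering v | covering≤1 v v≢0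
  ... | zero | _ = refl
  ... | suc zero | _ = refl
  ... | suc (suc _) | s≤s ()

  isHole⇔ : ∀ v → isHole v ≡ true ⇔ (v ≢ zeroV × ∀ i → ¬ v ∈ₛ B i)
  isHole⇔ v = mk⇔ to from
    where
    to : isHole v ≡ true → v ≢ zeroV × ∀ i → ¬ v ∈ₛ B i
    to hole = nonzero⇒≢ (∧-conicalˡ _ _ hole) , v∉
      where
      uncovered : covering v ≡ 0
      uncovered = ≡ᵇ⇒≡ (covering v) 0 (Bool.T-≡ .Equivalence.from (∧-conicalʳ _ _ hole))
      v∉ : ∀ i → ¬ v ∈ₛ B i
      v∉ i v∈ = <⇒≢ (∈⇒multiplicity>0 i v v∈) (sym (sum≡0⇒ (λ i → multiplicity i v) uncovered i))
    from : v ≢ zeroV × (∀ i → ¬ v ∈ₛ B i) → isHole v ≡ true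
    from (v≢0 , v∉) = cong₂ _∧_ (nonzero-true v≢0) (cong (_≡ᵇ 0) (sum-zero _ unrepresented))
      where
      unrepresented : ∀ i → multiplicity i v ≡ 0
      unrepresented i = n≤0⇒n≡0 (≮⇒≥ (v∉ i ∘ multiplicity>0⇒∈ i v))

  sumV-partition : (g : Vec₂ n → ℕ) → g zeroV ≡ 0 →
    sumV n g ≡ sumV n (λ v → g v * ⟦ isHole v ⟧) + sum (λ i → sumV k (λ c → g (lincomb c (basis (B i)))))
  sumV-partition g g0≡0 = begin
    sumV n g                                                              ≡⟨ sumV-cong split ⟩
    sumV n (λ v → g v * ⟦ isHole v ⟧ + g v * covering v)                  ≡⟨ sumV-distrib-+ (λ v → g v * ⟦ isHole v ⟧) _ ⟩
    sumV n (λ v → g v * ⟦ isHole v ⟧) + sumV n (λ v → g v * covering v)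
      ≡⟨ cong (sumV n (λ v → g v * ⟦ isHole v ⟧) +_) blocks ⟩
    sumV n (λ v → g v * ⟦ isHole v ⟧) + sum (λ i → sumV k (λ c → g (lincomb c (basis (B i))))) ∎
    where
    open ≡-Reasoning
    split : ∀ v → g v ≡ g v * ⟦ isHole v ⟧ + g v * covering v
    split v = by-cases (≡-dec Bool._≟_ v zeroV)
      where
      by-cases : Dec (v ≡ zeroV) → g v ≡ g v * ⟦ isHole v ⟧ + g v * covering v
      by-cases (yes refl) rewrite g0≡0 = refl
      by-cases (no v≢0) = trans (sym (*-identityʳ (g v)))
                         (trans (cong (g v *_) (sym (hole+covering v v≢0))) (*-distribˡ-+ (g v) _ _))
    blocks : sumV n (λ v → g v * covering v) ≡ sum (λ i → sumV k (λ c → g (lincomb c (basis (B i)))))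
    blocks = begin
      sumV n (λ v → g v * covering v)                   ≡⟨ sumV-cong (λ v → *-distribˡ-sum (g v) (λ i → multiplicity i v)) ⟩
      sumV n (λ v → sum (λ i → g v * multiplicity i v)) ≡⟨ sumV-sum-comm m (λ i v → g v * multiplicity i v) ⟩
      sum (λ i → sumV n (λ v → g v * multiplicity i v))
        ≡⟨ sum-cong-≗ (λ i → sumV-pushforward (λ c → lincomb c (basis (B i))) g) ⟩
      sum (λ i → sumV k (λ c → g (lincomb c (basis (B i))))) ∎

  isHole⇒nonzero : ∀ v → isHole v ≡ true → nonzero v ≡ true
  isHole⇒nonzero v = ∧-conicalˡ _ _

  count-nonzero≡holes+blocks : count n nonzero ≡ count n isHole + sum (λ (_ : Fin m) → count k nonzero)
  count-nonzero≡holes+blocks = begin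
    count n nonzero ≡⟨ sumV-partition (λ v → ⟦ nonzero v ⟧) (cong (λ b → ⟦ not b ⟧) (==-refl (zeroV {n}))) ⟩
    sumV n (λ v → ⟦ nonzero v ⟧ * ⟦ isHole v ⟧) + sum (λ i → count k (λ c → nonzero (lincomb c (basis (B i)))))
      ≡⟨ cong₂ _+_ (sumV-cong (λ v → trans (sym (⟦∧⟧ (nonzero v) (isHole v))) (cong ⟦_⟧ (nonzero∧hole v))))
                   (sum-cong-≗ (λ i → sumV-cong (λ c → cong ⟦_⟧ (nonzero-lincomb (indep (B i)) c)))) ⟩
    count n isHole + sum (λ (_ : Fin m) → count k nonzero) ∎
    where
    open ≡-Reasoning
    nonzero∧hole : ∀ v → nonzero v ∧ isHole v ≡ isHole v
    nonzero∧hole v with isHole v in hole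
    ... | true = trans (∧-identityʳ (nonzero v)) (isHole⇒nonzero v hole)
    ... | false = ∧-zeroʳ (nonzero v)

  holesOff : Vec₂ n → ℕ
  holesOff a = count n (λ v → isHole v ∧ dot a v)

  count-dot≡holesOff+blocks : ∀ a →
    count n (λ v → dot a v) ≡ holesOff a + sum (λ i → count k (λ c → dot c (map (dot a) (basis (B i)))))
  count-dot≡holesOff+blocks a = begin
    count n (λ v → dot a v)
      ≡⟨ sumV-partition (λ v → ⟦ dot a v ⟧) (cong ⟦_⟧ (dot-zeroʳ a)) ⟩
    sumV n (λ v → ⟦ dot a v ⟧ * ⟦ isHole v ⟧) + sum (λ i → count k (λ c → dot a (lincomb c (basis (B i)))))
      ≡⟨ cong₂ _+_ (sumV-cong (λ v → trans (*-comm ⟦ dot a v ⟧ _) (sym (⟦∧⟧ (isHole v) (dot a v)))))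
                   (sum-cong-≗ (λ i → sumV-cong (λ c → cong ⟦_⟧ (dot-lincomb a c (basis (B i)))))) ⟩
    holesOff a + sum (λ i → count k (λ c → dot c (map (dot a) (basis (B i))))) ∎
    where open ≡-Reasoning

-- Eight points meeting every hyperplane complement in a multiple of four points

4∣⇒≤8⇒ : ∀ {x} → 4 ∣ x → x ≤ 8 → x ≡ 0 ⊎ x ≡ 4 ⊎ x ≡ 8
4∣⇒≤8⇒ (divides 0 refl) _ = inj₁ refl
4∣⇒≤8⇒ (divides 1 refl) _ = inj₂ (inj₁ refl)
4∣⇒≤8⇒ (divides 2 refl) _ = inj₂ (inj₂ refl)
4∣⇒≤8⇒ (divides (suc (suc (suc _))) refl) (s≤s (s≤s (s≤s (s≤s (s≤s (s≤s (s≤s (s≤s ()))))))))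

module DivisibleOctad
  (hole : Vec₂ 7 → Bool)
  (hole⇒≢0 : ∀ v → hole v ≡ true → v ≢ zeroV)
  (count-hole : count 7 hole ≡ 8)
  (4∣holesOff : ∀ a → 4 ∣ count 7 (λ v → hole v ∧ dot a v)) where

  holesOff : Vec₂ 7 → ℕ
  holesOff a = count 7 (λ v → hole v ∧ dot a v)

  holesOff∈048 : ∀ a → holesOff a ≡ 0 ⊎ holesOff a ≡ 4 ⊎ holesOff a ≡ 8
  holesOff∈048 a = 4∣⇒≤8⇒ (4∣holesOff a) (≤-trans (count-mono (λ v → ∧-conicalˡ (hole v) _)) (≤-reflexive count-hole))

  count-dot₇ : ∀ {v} → v ≢ zeroV → count 7 (λ a → dot a v) ≡ 64
  count-dot₇ v≢0 = *-cancelˡ-≡ _ 64 2 (count-dot-nonzero v≢0)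

  count-dot-dot₇ : ∀ {u v} → u ≢ zeroV → v ≢ zeroV → count 7 (λ a → dot a u ∧ dot a v) ≡ 32 + 32 * ⟦ u == v ⟧
  count-dot-dot₇ {u} {v} u≢0 v≢0 = *-cancelˡ-≡ _ _ 4 (trans (count-dot-dot u≢0 v≢0) (scale ⟦ u == v ⟧))
    where
    scale : ∀ x → 128 + 128 * x ≡ 4 * (32 + 32 * x)
    scale = solve-∀

  sum-holesOff : sumV 7 holesOff ≡ 512
  sum-holesOff = begin
    sumV 7 (λ a → count 7 (λ v → hole v ∧ dot a v)) ≡⟨ sumV-comm 7 7 (λ a v → ⟦ hole v ∧ dot a v ⟧) ⟩
    sumV 7 (λ v → count 7 (λ a → hole v ∧ dot a v)) ≡⟨ sumV-cong (λ v → count-∧ˡ (hole v) (λ a → dot a v)) ⟩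
    sumV 7 (λ v → ⟦ hole v ⟧ * count 7 (λ a → dot a v))
      ≡⟨ sumV-cong (λ v → ⟦⟧*-cong (hole v) (count-dot₇ ∘ hole⇒≢0 v)) ⟩
    sumV 7 (λ v → ⟦ hole v ⟧ * 64) ≡⟨ sumV-*ʳ 64 (λ v → ⟦ hole v ⟧) ⟩
    count 7 hole * 64 ≡⟨ cong (_* 64) {x = count 7 hole} {y = 8} count-hole ⟩
    8 * 64 ∎
    where open ≡-Reasoning

  -- Σₐ holesOff(a)² sums this weight over all pairs of holes; it only depends on whether they coincide.
  pair-weight : ∀ u v → sumV 7 (λ a → ⟦ hole u ∧ dot a u ⟧ * ⟦ hole v ∧ dot a v ⟧)
               ≡ ⟦ hole u ∧ hole v ⟧ * (32 + 32 * ⟦ u == v ⟧)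
  pair-weight u v = begin
    sumV 7 (λ a → ⟦ hole u ∧ dot a u ⟧ * ⟦ hole v ∧ dot a v ⟧)
      ≡⟨ sumV-cong (λ a → trans (sym (⟦∧⟧ (hole u ∧ dot a u) (hole v ∧ dot a v)))
                                (cong ⟦_⟧ (∧-interchange (hole u) (dot a u) (hole v) (dot a v)))) ⟩
    count 7 (λ a → (hole u ∧ hole v) ∧ (dot a u ∧ dot a v))
      ≡⟨ count-∧ˡ (hole u ∧ hole v) (λ a → dot a u ∧ dot a v) ⟩
    ⟦ hole u ∧ hole v ⟧ * count 7 (λ a → dot a u ∧ dot a v)
      ≡⟨ ⟦⟧*-cong (hole u ∧ hole v) (λ both →
           count-dot-dot₇ (hole⇒≢0 u (∧-conicalˡ _ _ both)) (hole⇒≢0 v (∧-conicalʳ _ _ both))) ⟩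
    ⟦ hole u ∧ hole v ⟧ * (32 + 32 * ⟦ u == v ⟧) ∎
    where open ≡-Reasoning

  row-weight : ∀ u → sumV 7 (λ v → ⟦ hole u ∧ hole v ⟧ * (32 + 32 * ⟦ u == v ⟧)) ≡ 288 * ⟦ hole u ⟧
  row-weight u = begin
    sumV 7 (λ v → ⟦ hole u ∧ hole v ⟧ * (32 + 32 * ⟦ u == v ⟧))
      ≡⟨ sumV-cong (λ v → trans (cong (_* (32 + 32 * ⟦ u == v ⟧)) (⟦∧⟧ (hole u) (hole v)))
                                (expand ⟦ hole u ⟧ ⟦ hole v ⟧ ⟦ u == v ⟧)) ⟩
    sumV 7 (λ v → ⟦ hole u ⟧ * (32 * ⟦ hole v ⟧ + 32 * (⟦ u == v ⟧ * ⟦ hole v ⟧)))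
      ≡⟨ sumV-*ˡ ⟦ hole u ⟧ _ ⟩
    ⟦ hole u ⟧ * sumV 7 (λ v → 32 * ⟦ hole v ⟧ + 32 * (⟦ u == v ⟧ * ⟦ hole v ⟧))
      ≡⟨ cong (⟦ hole u ⟧ *_) (sumV-distrib-+ (λ v → 32 * ⟦ hole v ⟧) _) ⟩
    ⟦ hole u ⟧ * (sumV 7 (λ v → 32 * ⟦ hole v ⟧) + sumV 7 (λ v → 32 * (⟦ u == v ⟧ * ⟦ hole v ⟧)))
      ≡⟨ cong (⟦ hole u ⟧ *_) (cong₂ _+_ (trans (sumV-*ˡ 32 _) (cong (32 *_) count-hole))
                                         (trans (sumV-*ˡ 32 _) (cong (32 *_) (sumV-delta u (λ v → ⟦ hole v ⟧))))) ⟩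
    ⟦ hole u ⟧ * (256 + 32 * ⟦ hole u ⟧) ≡⟨ collapse (hole u) ⟩
    288 * ⟦ hole u ⟧ ∎
    where
    open ≡-Reasoning
    expand : ∀ x y e → (x * y) * (32 + 32 * e) ≡ x * (32 * y + 32 * (e * y))
    expand = solve-∀
    collapse : ∀ p → ⟦ p ⟧ * (256 + 32 * ⟦ p ⟧) ≡ 288 * ⟦ p ⟧
    collapse true = refl
    collapse false = refl

  sum-holesOff² : sumV 7 (λ a → holesOff a * holesOff a) ≡ 2304
  sum-holesOff² = begin
    sumV 7 (λ a → holesOff a * holesOff a)
      ≡⟨ sumV-cong (λ a → sumV-*-sumV (λ u → ⟦ hole u ∧ dot a u ⟧) (λ v → ⟦ hole v ∧ dot a v ⟧)) ⟩
    sumV 7 (λ a → sumV 7 (λ u → sumV 7 (λ v → ⟦ hole u ∧ dot a u ⟧ * ⟦ hole v ∧ dot a v ⟧)))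
      ≡⟨ trans (sumV-comm 7 7 (λ a u → sumV 7 (λ v → T a u v))) (sumV-cong (λ u → sumV-comm 7 7 (λ a v → T a u v))) ⟩
    sumV 7 (λ u → sumV 7 (λ v → sumV 7 (λ a → ⟦ hole u ∧ dot a u ⟧ * ⟦ hole v ∧ dot a v ⟧)))
      ≡⟨ sumV-cong (λ u → sumV-cong (λ v → pair-weight u v)) ⟩
    sumV 7 (λ u → sumV 7 (λ v → ⟦ hole u ∧ hole v ⟧ * (32 + 32 * ⟦ u == v ⟧)))
      ≡⟨ sumV-cong row-weight ⟩
    sumV 7 (λ u → 288 * ⟦ hole u ⟧)
      ≡⟨ trans (sumV-*ˡ 288 (λ u → ⟦ hole u ⟧)) (cong (288 *_) count-hole) ⟩
    288 * 8 ∎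
    where
    open ≡-Reasoning
    T : Vec₂ 7 → Vec₂ 7 → Vec₂ 7 → ℕ
    T a u v = ⟦ hole u ∧ dot a u ⟧ * ⟦ hole v ∧ dot a v ⟧

  count-holesOff≡8 : count 7 (λ a → holesOff a ≡ᵇ 8) ≡ 8
  count-holesOff≡8 = *-cancelˡ-≡ _ _ 32 (+-cancelˡ-≡ 2048 _ _ (begin
    2048 + 32 * count 7 (λ a → holesOff a ≡ᵇ 8)         ≡⟨ cong₂ _+_ (cong (4 *_) (sym sum-holesOff)) (sym (sumV-*ˡ 32 _)) ⟩
    4 * sumV 7 holesOff + sumV 7 (λ a → 32 * ⟦ holesOff a ≡ᵇ 8 ⟧)
      ≡⟨ cong (_+ sumV 7 (λ a → 32 * ⟦ holesOff a ≡ᵇ 8 ⟧)) (sym (sumV-*ˡ 4 holesOff)) ⟩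
    sumV 7 (λ a → 4 * holesOff a) + sumV 7 (λ a → 32 * ⟦ holesOff a ≡ᵇ 8 ⟧) ≡⟨ sym (sumV-distrib-+ _ _) ⟩
    sumV 7 (λ a → 4 * holesOff a + 32 * ⟦ holesOff a ≡ᵇ 8 ⟧) ≡⟨ sumV-cong (λ a → sym (square (holesOff∈048 a))) ⟩
    sumV 7 (λ a → holesOff a * holesOff a)                    ≡⟨ sum-holesOff² ⟩
    2048 + 32 * 8 ∎))
    where
    open ≡-Reasoning
    square : ∀ {x} → x ≡ 0 ⊎ x ≡ 4 ⊎ x ≡ 8 → x * x ≡ 4 * x + 32 * ⟦ x ≡ᵇ 8 ⟧
    square (inj₁ refl) = refl
    square (inj₂ (inj₁ refl)) = refl
    square (inj₂ (inj₂ refl)) = refl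

  ∃holesOff≡8 : ∃[ a₀ ] (holesOff a₀ ≡ᵇ 8) ≡ true
  ∃holesOff≡8 = count-witness _ (subst (0 <_) (sym count-holesOff≡8) (s≤s z≤n))

  a₀ : Vec₂ 7
  a₀ = proj₁ ∃holesOff≡8

  hole⇒dot-a₀ : ∀ x → hole x ≡ true → dot a₀ x ≡ true
  hole⇒dot-a₀ x hx = ∧-conicalʳ _ _ (count-⊆-≡⇒⊇ (λ v → ∧-conicalˡ (hole v) _) holesOff≡count x hx)
    where
    holesOff≡count : holesOff a₀ ≡ count 7 hole
    holesOff≡count = trans (≡ᵇ⇒≡ _ 8 (Bool.T-≡ .Equivalence.from (proj₂ ∃holesOff≡8))) (sym count-hole)

  annihilates : Vec₂ 7 → Bool
  annihilates a = holesOff a ≡ᵇ 0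

  count-annihilates : count 7 annihilates ≡ 8
  count-annihilates = *-cancelˡ-≡ _ _ 4 (+-cancelʳ-≡ 512 _ _ (begin
    4 * count 7 annihilates + 512          ≡⟨ cong₂ _+_ (sym (sumV-*ˡ 4 _)) (sym sum-holesOff) ⟩
    sumV 7 (λ a → 4 * ⟦ holesOff a ≡ᵇ 0 ⟧) + sumV 7 holesOff ≡⟨ sym (sumV-distrib-+ _ _) ⟩
    sumV 7 (λ a → 4 * ⟦ holesOff a ≡ᵇ 0 ⟧ + holesOff a)     ≡⟨ sumV-cong (λ a → linear (holesOff∈048 a)) ⟩
    sumV 7 (λ a → 4 + 4 * ⟦ holesOff a ≡ᵇ 8 ⟧)          ≡⟨ sumV-distrib-+ _ _ ⟩
    sumV 7 (λ _ → 4) + sumV 7 (λ a → 4 * ⟦ holesOff a ≡ᵇ 8 ⟧)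
      ≡⟨ cong₂ _+_ (sumV-const 7 4) (trans (sumV-*ˡ 4 _) (cong (4 *_) count-holesOff≡8)) ⟩
    4 * 8 + 512 ∎))
    where
    open ≡-Reasoning
    linear : ∀ {x} → x ≡ 0 ⊎ x ≡ 4 ⊎ x ≡ 8 → 4 * ⟦ x ≡ᵇ 0 ⟧ + x ≡ 4 + 4 * ⟦ x ≡ᵇ 8 ⟧
    linear (inj₁ refl) = refl
    linear (inj₂ (inj₁ refl)) = refl
    linear (inj₂ (inj₂ refl)) = refl

  annihilates⇔ : ∀ a → annihilates a ≡ true ⇔ (∀ x → hole x ≡ true → dot a x ≡ false)
  annihilates⇔ a = count-∧≡0⇔ hole (dot a)

  ⊕-annihilates : ∀ a b → annihilates a ≡ true → annihilates b ≡ true → annihilates (a ⊕ b) ≡ true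
  ⊕-annihilates a b a⊥ b⊥ = annihilates⇔ (a ⊕ b) .Equivalence.from λ x hx →
    trans (dot-⊕ˡ a b x) (cong₂ _xor_ (annihilates⇔ a .Equivalence.to a⊥ x hx) (annihilates⇔ b .Equivalence.to b⊥ x hx))

  perp : Vec₂ 7 → Bool
  perp v = count 7 (λ a → annihilates a ∧ dot a v) ≡ᵇ 0

  perp⇔ : ∀ v → perp v ≡ true ⇔ (∀ a → annihilates a ≡ true → dot a v ≡ false)
  perp⇔ v = count-∧≡0⇔ annihilates (λ a → dot a v)

  ⊕-perp : ∀ u v → perp u ≡ true → perp v ≡ true → perp (u ⊕ v) ≡ true
  ⊕-perp u v u⊥ v⊥ = perp⇔ (u ⊕ v) .Equivalence.from λ a a⊥ →
    trans (dot-⊕ʳ a u v) (cong₂ _xor_ (perp⇔ u .Equivalence.to u⊥ a a⊥) (perp⇔ v .Equivalence.to v⊥ a a⊥))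

  annihilates-zero : annihilates zeroV ≡ true
  annihilates-zero = annihilates⇔ zeroV .Equivalence.from (λ x _ → trans (dot-comm zeroV x) (dot-zeroʳ x))

  annihilated : Vec₂ 7 → ℕ
  annihilated v = count 7 (λ a → annihilates a ∧ dot a v)

  annihilated∈04 : ∀ v → annihilated v ≡ 0 ⊎ annihilated v ≡ 4
  annihilated∈04 v with count-dot-closed annihilates ⊕-annihilates v
  ... | inj₁ ≡0 = inj₁ ≡0
  ... | inj₂ 2*≡8 = inj₂ (*-cancelˡ-≡ _ 4 2 (trans 2*≡8 count-annihilates))

  sum-annihilated : sumV 7 annihilated ≡ 448
  sum-annihilated = begin
    sumV 7 (λ v → count 7 (λ a → annihilates a ∧ dot a v))
      ≡⟨ sumV-comm 7 7 (λ v a → ⟦ annihilates a ∧ dot a v ⟧) ⟩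
    sumV 7 (λ a → count 7 (λ v → annihilates a ∧ dot a v))
      ≡⟨ sumV-cong (λ a → count-∧ˡ (annihilates a) (dot a)) ⟩
    sumV 7 (λ a → ⟦ annihilates a ⟧ * count 7 (dot a))
      ≡⟨ sumV-cong (λ a → cong (⟦ annihilates a ⟧ *_)
                               (*-cancelˡ-≡ _ _ 2 (trans (count-dotˡ a) (*-assoc 2 64 ⟦ nonzero a ⟧)))) ⟩
    sumV 7 (λ a → ⟦ annihilates a ⟧ * (64 * ⟦ nonzero a ⟧))
      ≡⟨ sumV-cong (λ a → trans (regroup ⟦ annihilates a ⟧ ⟦ nonzero a ⟧)
                                (cong (64 *_) (sym (⟦∧⟧ (annihilates a) (nonzero a))))) ⟩
    sumV 7 (λ a → 64 * ⟦ annihilates a ∧ nonzero a ⟧)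
      ≡⟨ trans (sumV-*ˡ 64 _) (cong (64 *_) count-nonzero-annihilators) ⟩
    64 * 7 ∎
    where
    open ≡-Reasoning
    regroup : ∀ x y → x * (64 * y) ≡ 64 * (x * y)
    regroup = solve-∀
    count-nonzero-annihilators : count 7 (λ a → annihilates a ∧ nonzero a) ≡ 7
    count-nonzero-annihilators = +-cancelˡ-≡ 1 _ _ (begin
      1 + count 7 (λ a → annihilates a ∧ nonzero a)
        ≡⟨ cong (_+ count 7 (λ a → annihilates a ∧ nonzero a))
                (sym (trans (count-∧-== annihilates zeroV) (cong ⟦_⟧ annihilates-zero))) ⟩
      count 7 (λ a → annihilates a ∧ (a == zeroV)) + count 7 (λ a → annihilates a ∧ nonzero a)
        ≡⟨ count-split annihilates (_== zeroV) ⟩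
      count 7 annihilates ≡⟨ count-annihilates ⟩
      1 + 7 ∎)

  count-perp : count 7 perp ≡ 16
  count-perp = *-cancelˡ-≡ _ _ 4 (+-cancelˡ-≡ 448 _ _ (begin
    448 + 4 * count 7 perp ≡⟨ cong₂ _+_ (sym sum-annihilated) (sym (sumV-*ˡ 4 _)) ⟩
    sumV 7 annihilated + sumV 7 (λ v → 4 * ⟦ perp v ⟧) ≡⟨ sym (sumV-distrib-+ _ _) ⟩
    sumV 7 (λ v → annihilated v + 4 * ⟦ perp v ⟧) ≡⟨ sumV-cong (λ v → complement (annihilated∈04 v)) ⟩
    sumV 7 (λ _ → 4) ≡⟨ sumV-const 7 4 ⟩
    448 + 4 * 16 ∎))
    where
    open ≡-Reasoning
    complement : ∀ {x} → x ≡ 0 ⊎ x ≡ 4 → x + 4 * ⟦ x ≡ᵇ 0 ⟧ ≡ 4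
    complement (inj₁ refl) = refl
    complement (inj₂ refl) = refl

  solid : Vec₂ 7 → Bool
  solid v = perp v ∧ dot v a₀

  hole⇒solid : ∀ x → hole x ≡ true → solid x ≡ true
  hole⇒solid x hx = cong₂ _∧_
    (perp⇔ x .Equivalence.from (λ a a⊥ → annihilates⇔ a .Equivalence.to a⊥ x hx))
    (trans (dot-comm x a₀) (hole⇒dot-a₀ x hx))

  count-solid : count 7 solid ≡ 8
  count-solid = [ (λ ≡0 → ⊥-elim (8≰0 (≤-trans (≤-reflexive (sym count-hole))
                                               (≤-trans (count-mono hole⇒solid) (≤-reflexive ≡0)))))
                , (λ 2*≡16 → *-cancelˡ-≡ _ 8 2 (trans 2*≡16 count-perp)) ]′ (count-dot-closed perp ⊕-perp a₀)
    where
    8≰0 : ¬ 8 ≤ 0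
    8≰0 ()

  solid⇒hole : ∀ v → solid v ≡ true → hole v ≡ true
  solid⇒hole = count-⊆-≡⇒⊇ hole⇒solid (trans count-hole (sym count-solid))

  hole-closed : ∀ x y w → hole x ≡ true → hole y ≡ true → hole w ≡ true → hole (x ⊕ (y ⊕ w)) ≡ true
  hole-closed x y w hx hy hw = solid⇒hole _ (cong₂ _∧_
    (⊕-perp x _ (perp-of hx) (⊕-perp y w (perp-of hy) (perp-of hw)))
    (trans (dot-⊕ˡ x (y ⊕ w) a₀) (trans (cong (dot x a₀ xor_) (dot-⊕ˡ y w a₀))
      (cong₂ _xor_ (dot-a₀ hx) (cong₂ _xor_ (dot-a₀ hy) (dot-a₀ hw))))))
    where
    perp-of : ∀ {z} → hole z ≡ true → perp z ≡ true
    perp-of hz = ∧-conicalˡ _ _ (hole⇒solid _ hz)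
    dot-a₀ : ∀ {z} → hole z ≡ true → dot z a₀ ≡ true
    dot-a₀ hz = ∧-conicalʳ _ _ (hole⇒solid _ hz)

-- Eight points closed under sums of three

evenBasis : Vec (Vec₂ 4) 3
evenBasis = (true ∷ true ∷ false ∷ false ∷ [])
          ∷ (true ∷ false ∷ true ∷ false ∷ [])
          ∷ (true ∷ false ∷ false ∷ true ∷ [])
          ∷ []

evenBasis-indep : LinIndep evenBasis
evenBasis-indep (false ∷ false ∷ false ∷ []) _ = refl
evenBasis-indep (false ∷ false ∷ true ∷ []) ()
evenBasis-indep (false ∷ true ∷ false ∷ []) ()
evenBasis-indep (false ∷ true ∷ true ∷ []) ()
evenBasis-indep (true ∷ false ∷ false ∷ []) ()
evenBasis-indep (true ∷ false ∷ true ∷ []) ()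
evenBasis-indep (true ∷ true ∷ false ∷ []) ()
evenBasis-indep (true ∷ true ∷ true ∷ []) ()

parity-evenBasis : ∀ c → parity (lincomb c evenBasis) ≡ false
parity-evenBasis c = trans (dot-comm (lincomb c evenBasis) _)
  (trans (dot-lincomb (replicate 4 true) c evenBasis) (dot-zeroʳ c))

even⇒∈evenBasis : ∀ d → parity d ≡ false → ∃[ c ] lincomb c evenBasis ≡ d
even⇒∈evenBasis (false ∷ false ∷ false ∷ false ∷ []) _ = (false ∷ false ∷ false ∷ []) , refl
even⇒∈evenBasis (true ∷ true ∷ false ∷ false ∷ []) _ = (true ∷ false ∷ false ∷ []) , refl
even⇒∈evenBasis (true ∷ false ∷ true ∷ false ∷ []) _ = (false ∷ true ∷ false ∷ []) , refl
even⇒∈evenBasis (true ∷ false ∷ false ∷ true ∷ []) _ = (false ∷ false ∷ true ∷ []) , refl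
even⇒∈evenBasis (false ∷ true ∷ true ∷ false ∷ []) _ = (true ∷ true ∷ false ∷ []) , refl
even⇒∈evenBasis (false ∷ true ∷ false ∷ true ∷ []) _ = (true ∷ false ∷ true ∷ []) , refl
even⇒∈evenBasis (false ∷ false ∷ true ∷ true ∷ []) _ = (false ∷ true ∷ true ∷ []) , refl
even⇒∈evenBasis (true ∷ true ∷ true ∷ true ∷ []) _ = (true ∷ true ∷ true ∷ []) , refl
even⇒∈evenBasis (true ∷ false ∷ false ∷ false ∷ []) ()
even⇒∈evenBasis (false ∷ true ∷ false ∷ false ∷ []) ()
even⇒∈evenBasis (false ∷ false ∷ true ∷ false ∷ []) ()
even⇒∈evenBasis (false ∷ false ∷ false ∷ true ∷ []) ()
even⇒∈evenBasis (true ∷ true ∷ true ∷ false ∷ []) ()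
even⇒∈evenBasis (true ∷ true ∷ false ∷ true ∷ []) ()
even⇒∈evenBasis (true ∷ false ∷ true ∷ true ∷ []) ()
even⇒∈evenBasis (false ∷ true ∷ true ∷ true ∷ []) ()

module ThreeSumClosed {n} (hole : Vec₂ n → Bool) (a₀ : Vec₂ n)
  (hole⇒dot-a₀ : ∀ x → hole x ≡ true → dot a₀ x ≡ true)
  (hole-closed : ∀ x y w → hole x ≡ true → hole y ≡ true → hole w ≡ true → hole (x ⊕ (y ⊕ w)) ≡ true)
  (count-hole : count n hole ≡ 8) where

  Hole : Vec₂ n → Set
  Hole x = hole x ≡ true

  dot-a₀-lincomb : ∀ {k} {xs : Vec (Vec₂ n) k} → All Hole xs → ∀ c → dot a₀ (lincomb c xs) ≡ parity c
  dot-a₀-lincomb {xs = xs} holes c = trans (dot-lincomb a₀ c xs) (cong (dot c) (all-true holes))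
    where
    all-true : ∀ {k} {xs : Vec (Vec₂ n) k} → All Hole xs → map (dot a₀) xs ≡ replicate k true
    all-true [] = refl
    all-true (hx ∷ hxs) = cong₂ _∷_ (hole⇒dot-a₀ _ hx) (all-true hxs)

  -- The even half strengthens the induction hypothesis enough for the odd half.
  combination-hole : ∀ {k} {xs : Vec (Vec₂ n) k} → All Hole xs → ∀ c →
    (parity c ≡ true → Hole (lincomb c xs)) × (parity c ≡ false → ∀ h → Hole h → Hole (lincomb c xs ⊕ h))
  combination-hole [] [] = (λ ()) , λ _ h hh → subst Hole (sym (⊕-identityˡ h)) hh
  combination-hole {xs = x ∷ xs} (hx ∷ hxs) (false ∷ c) =
    let odd , even = combination-hole hxs c
    in (λ p → subst Hole (sym (lincomb-false∷ c x xs)) (odd p))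
     , (λ p h hh → subst Hole (cong (_⊕ h) (sym (lincomb-false∷ c x xs))) (even p h hh))
  combination-hole {xs = x ∷ xs} (hx ∷ hxs) (true ∷ c) with parity c | combination-hole hxs c
  ... | true | odd , _ =
    (λ ()) , λ _ h hh → subst Hole (trans (sym (⊕-assoc x _ h)) (cong (_⊕ h) (sym (lincomb-true∷ c x xs))))
                                 (hole-closed x _ h hx (odd refl) hh)
  ... | false | _ , even =
    (λ _ → subst Hole (trans (⊕-comm _ x) (sym (lincomb-true∷ c x xs))) (even refl x hx)) , λ ()

  -- Fewer than eight vectors are odd combinations of xs, so some hole lies outside their span.
  extend-by-hole : ∀ {k} {xs : Vec (Vec₂ n) k} → LinIndep xs → All Hole xs → 2 ^ k < 16 →
    ∃[ x ] Hole x × LinIndep (x ∷ xs)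
  extend-by-hole {k} {xs} indep holes 2^k<16 = outside (sumV-<⇒∃ weight<count)
    where
    weight : Vec₂ n → ℕ
    weight v = count k (λ c → parity c ∧ (lincomb c xs == v))
    count-parity<8 : count k parity < 8
    count-parity<8 = *-cancelˡ-< 2 _ 8 (begin-strict
      2 * count k parity                     ≡⟨ count-dot (replicate k true) ⟩
      2 ^ k * ⟦ nonzero (replicate k true) ⟧ ≤⟨ *-monoʳ-≤ (2 ^ k) (⟦⟧≤1 _) ⟩
      2 ^ k * 1                              ≡⟨ *-identityʳ (2 ^ k) ⟩
      2 ^ k                                  <⟨ 2^k<16 ⟩
      16                                     ∎)
      where open ≤-Reasoning
    weight<count : sumV n weight < count n hole
    weight<count = subst (sumV n weight <_) (sym count-hole)
      (subst (_< 8) (sym (sumV-count-fibres (λ c → lincomb c xs) parity)) count-parity<8)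
    outside : ∃[ x ] weight x < ⟦ hole x ⟧ → ∃[ x ] Hole x × LinIndep (x ∷ xs)
    outside (x , weight<hole) = x , hx , LinIndep-∷ indep x∉span
      where
      hx : Hole x
      hx = ⟦⟧-pos (≤-<-trans z≤n weight<hole)
      x∉span : ∀ c → lincomb c xs ≢ x
      x∉span c c↦x = <⇒≱ (count-pos _ c (cong₂ _∧_ odd (trans (cong (_== x) c↦x) (==-refl x))))
                          (≤-pred (<-≤-trans weight<hole (⟦⟧≤1 (hole x))))
        where
        odd : parity c ≡ true
        odd = trans (sym (dot-a₀-lincomb holes c)) (trans (cong (dot a₀) c↦x) (hole⇒dot-a₀ x hx))

  -- Opaque because unfolding the four nested witnesses makes type checking blow up.
  opaque
    independent-holes : Σ (Vec (Vec₂ n) 4) λ xs → LinIndep xs × All Hole xs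
    independent-holes =
      let x₁ , h₁ , i₁ = extend-by-hole LinIndep-[] [] (≤ᵇ⇒≤ _ _ tt)
          x₂ , h₂ , i₂ = extend-by-hole i₁ (h₁ ∷ []) (≤ᵇ⇒≤ _ _ tt)
          x₃ , h₃ , i₃ = extend-by-hole i₂ (h₂ ∷ h₁ ∷ []) (≤ᵇ⇒≤ _ _ tt)
          x₄ , h₄ , i₄ = extend-by-hole i₃ (h₃ ∷ h₂ ∷ h₁ ∷ []) (≤ᵇ⇒≤ _ _ tt)
      in (x₄ ∷ x₃ ∷ x₂ ∷ x₁ ∷ []) , i₄ , (h₄ ∷ h₃ ∷ h₂ ∷ h₁ ∷ [])

  -- S is spanned by four independent holes and T by their even combinations;
  -- the holes are exactly the odd combinations.
  affine-solid : Σ (Subspace n 4) λ S → Σ (Subspace n 3) λ T → T ⊆ₛ S × (∀ v → Hole v ⇔ (v ∈ₛ S × ¬ v ∈ₛ T))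
  affine-solid = S , T , T⊆S , λ v → mk⇔ (hole⇒S∖T v) (S∖T⇒hole v)
    where
    xs : Vec (Vec₂ n) 4
    xs = proj₁ independent-holes
    xs-indep : LinIndep xs
    xs-indep = proj₁ (proj₂ independent-holes)
    holes : All Hole xs
    holes = proj₂ (proj₂ independent-holes)
    S : Subspace n 4
    S = subspace xs xs-indep
    ts : Vec (Vec₂ n) 3
    ts = map (λ d → lincomb d xs) evenBasis
    ∈T⇒even : ∀ {v} c → lincomb c ts ≡ v → lincomb (lincomb c evenBasis) xs ≡ v
    ∈T⇒even c eq = trans (sym (lincomb-map c evenBasis xs)) eq
    T : Subspace n 3
    T = subspace ts (λ c eq → evenBasis-indep c (xs-indep (lincomb c evenBasis) (∈T⇒even c eq)))
    T⊆S : T ⊆ₛ S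
    T⊆S v (c , eq) = lincomb c evenBasis , ∈T⇒even c eq
    count-odd : count 4 parity ≡ count n hole
    count-odd = trans (*-cancelˡ-≡ _ 8 2 (count-dot (replicate 4 true))) (sym count-hole)
    hole⇒S∖T : ∀ v → Hole v → v ∈ₛ S × ¬ v ∈ₛ T
    hole⇒S∖T v hv =
      let d , _ , d↦v = count-image (λ d → lincomb d xs) (lincomb-injective xs-indep) parity hole
                          (λ d → proj₁ (combination-hole holes d)) count-odd v hv
      in (d , d↦v) , λ (c , c↦v) → true≢false (begin
        true                                         ≡⟨ sym (hole⇒dot-a₀ v hv) ⟩
        dot a₀ v                                     ≡⟨ cong (dot a₀) (sym (∈T⇒even c c↦v)) ⟩
        dot a₀ (lincomb (lincomb c evenBasis) xs)    ≡⟨ dot-a₀-lincomb holes (lincomb c evenBasis) ⟩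
        parity (lincomb c evenBasis)                 ≡⟨ parity-evenBasis c ⟩
        false                                        ∎)
      where
      open ≡-Reasoning
      true≢false : true ≢ false
      true≢false ()
    S∖T⇒hole : ∀ v → v ∈ₛ S × ¬ v ∈ₛ T → Hole v
    S∖T⇒hole v ((d , d↦v) , v∉T) with parity d in odd
    ... | true = subst Hole d↦v (proj₁ (combination-hole holes d) odd)
    ... | false = let c , c↦d = even⇒∈evenBasis d odd
                  in ⊥-elim (v∉T (c , trans (lincomb-map c evenBasis xs) (trans (cong (λ e → lincomb e xs) c↦d) d↦v)))

module PlaneSpread (B : Fin 17 → Subspace 7 3)
  (disjoint : ∀ i j → i ≢ j → ∀ v → v ∈ₛ B i → v ∈ₛ B j → v ≡ zeroV) where

  open PartialSpread B disjoint public

  count-isHole : count 7 isHole ≡ 8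
  count-isHole = +-cancelʳ-≡ 119 _ 8 (sym (begin
    127                                                     ≡⟨ +-cancelˡ-≡ 1 127 _ (sym (count-nonzero 7)) ⟩
    count 7 nonzero                                         ≡⟨ count-nonzero≡holes+blocks ⟩
    count 7 isHole + sum (λ (_ : Fin 17) → count 3 nonzero)
      ≡⟨ cong (count 7 isHole +_) (sum-cong-≗ {17} (λ _ → nonzero₃)) ⟩
    count 7 isHole + 119                                    ∎))
    where
    open ≡-Reasoning
    nonzero₃ : count 3 nonzero ≡ 7
    nonzero₃ = +-cancelˡ-≡ 1 _ 7 (count-nonzero 3)

  4∣holesOff : ∀ a → 4 ∣ holesOff a
  4∣holesOff a = ∣m+n∣m⇒∣n (subst (4 ∣_) total (∣-trans (divides 16 refl) (m∣m*n ⟦ nonzero a ⟧))) (m∣m*n blocks)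
    where
    blocks : ℕ
    blocks = sum (λ i → ⟦ nonzero (map (dot a) (basis (B i))) ⟧)
    meets : ∀ (w : Vec₂ 3) → count 3 (λ c → dot c w) ≡ 4 * ⟦ nonzero w ⟧
    meets w = *-cancelˡ-≡ _ _ 2 (trans (count-dot w) (*-assoc 2 4 ⟦ nonzero w ⟧))
    total : 64 * ⟦ nonzero a ⟧ ≡ 4 * blocks + holesOff a
    total = begin
      64 * ⟦ nonzero a ⟧ ≡⟨ *-cancelˡ-≡ _ _ 2 (trans (sym (*-assoc 2 64 ⟦ nonzero a ⟧)) (sym (count-dotˡ a))) ⟩
      count 7 (dot a)     ≡⟨ count-dot≡holesOff+blocks a ⟩
      holesOff a + sum (λ i → count 3 (λ c → dot c (map (dot a) (basis (B i)))))
        ≡⟨ cong (holesOff a +_) (sum-cong-≗ (λ i → meets (map (dot a) (basis (B i))))) ⟩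
      holesOff a + sum (λ i → 4 * ⟦ nonzero (map (dot a) (basis (B i))) ⟧)
        ≡⟨ cong (holesOff a +_) (sym (*-distribˡ-sum 4 (λ i → ⟦ nonzero (map (dot a) (basis (B i))) ⟧))) ⟩
      holesOff a + 4 * blocks ≡⟨ +-comm (holesOff a) _ ⟩
      4 * blocks + holesOff a ∎
      where open ≡-Reasoning

lemma3p3 : (𝒮 : PartialPlaneSpread 17) → IsAffineSolid (λ v → IsHole 𝒮 v)
lemma3p3 (B , disjoint) =
  let S , T , T⊆S , hole⇔S∖T = affine-solid
  in S , T , T⊆S , λ v _ → ⇔.trans (⇔.sym (isHole⇔ v)) (hole⇔S∖T v)
  where
  open PlaneSpread B disjoint
  open DivisibleOctad isHole (λ v → nonzero⇒≢ ∘ isHole⇒nonzero v) count-isHole 4∣holesOff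
  open ThreeSumClosed isHole a₀ hole⇒dot-a₀ hole-closed count-isHole
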